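{- Let $r\ge 2$ and let $Q\subseteq P(r)$ be such that $M=(r)\in Q$, $R=(1,1,\ldots,1)\notin Q$, and $Q$ is not reduction-closed. Then the $\Sigma$-hypergraph $H=H(r^2,r,r\mid\Sigma=Q)$ (on $r^3$ vertices) has a gap in its $Q$-spectrum.
   Context: $P(r)$ denotes the set of all partitions of $r$. For $\Sigma\subseteq P(r)$ and positive integers $n,q$, the $\Sigma$-hypergraph $H(n,r,q\mid\Sigma)$ is the $r$-uniform hypergraph whose vertex set is partitioned into $n$ classes $V_1,\ldots,V_n$ of $q$ vertices each, in which an $r$-subset $K$ of vertices is an edge iff the partition of $r$ formed by the nonzero numbers $|K\cap V_i|$ belongs to $\Sigma$. Given a vertex colouring, the pattern $pat(E)$ of an edge $E$ is the partition of $r$ formed by the numbers of vertices of $E$ of each colour present in $E$. A $Q$-colouring is a vertex colouring with $pat(E)\in Q$ for all edges $E$; a $k$-$Q$-colouring is a $Q$-colouring using exactly $k$ colours. The $Q$-spectrum is the set of all $k$ for which a $k$-$Q$-colouring exists; it has a gap if there are integers $k_1<k_2<k_3$ with $k_1,k_3$ in the spectrum and $k_2$ not. A partition $\pi$ is obtained from $\sigma$ by reduction if $\pi$ arises by replacing two parts $a_i,a_j$ of $\sigma$ (at distinct positions) by the single part $a_i+a_j$; $Q$ is reduction-closed if every partition obtained by a reduction from a member of $Q$ lies in $Q$. -}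

module Defs where

open import Data.Nat using (ℕ; zero; suc; _+_; _*_; _<_; _≤_)
open import Data.Bool using (Bool; true; false; _∧_; if_then_else_)
open import Data.Fin using (Fin)
open import Data.Fin.Properties using (_≟_)
open import Data.List using (List; []; _∷_; filter; replicate)
open import Data.Nat.ListAction using (sum)
open import Data.List.Relation.Unary.All using (All)
open import Data.List.Relation.Binary.Permutation.Propositional using (_↭_)
open import Data.Product using (Σ; _×_; _,_; ∃; ∃-syntax)
open import Relation.Nullary using (¬_; does)
open import Relation.Unary using (Pred)
open import Relation.Binary.PropositionalEquality using (_≡_)
open import Level using (0ℓ)

ΣFin : (n : ℕ) → (Fin n → ℕ) → ℕ
ΣFin zero    f = 0
ΣFin (suc n) f = f Fin.zero + ΣFin n (λ i → f (Fin.suc i))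

tab : (n : ℕ) → (Fin n → ℕ) → List ℕ
tab zero    f = []
tab (suc n) f = f Fin.zero ∷ tab n (λ i → f (Fin.suc i))

isPos : ℕ → Bool
isPos zero    = false
isPos (suc _) = true

nonzeros : List ℕ → List ℕ
nonzeros []       = []
nonzeros (x ∷ xs) = if isPos x then x ∷ nonzeros xs else nonzeros xs

b2n : Bool → ℕ
b2n true  = 1
b2n false = 0

-- Partitions of r, represented as lists of positive parts summing to r
-- (order irrelevant; partitions are compared up to permutation _↭_).

IsPartition : ℕ → List ℕ → Set
IsPartition r σ = All (λ a → 1 ≤ a) σ × sum σ ≡ r

-- A family Q ⊆ P(r), given as a (decidable) predicate on lists that
-- only contains partitions of r and is invariant under reordering
-- (so it really is a set of partitions, i.e. of multisets).
IsPartitionFamily : ℕ → (List ℕ → Bool) → Set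
IsPartitionFamily r Q =
  (∀ σ → Q σ ≡ true → IsPartition r σ) ×
  (∀ σ τ → σ ↭ τ → Q σ ≡ Q τ)

Reduction : List ℕ → List ℕ → Set
Reduction σ π = ∃[ a ] ∃[ b ] ∃[ xs ] (σ ↭ (a ∷ b ∷ xs) × π ↭ ((a + b) ∷ xs))

ReductionClosed : (List ℕ → Bool) → Set
ReductionClosed Q = ∀ σ π → Q σ ≡ true → Reduction σ π → Q π ≡ true

NotReductionClosed : (List ℕ → Bool) → Set
NotReductionClosed Q = ∃[ σ ] ∃[ π ] (Q σ ≡ true × Reduction σ π × Q π ≡ false)

-- The Σ-hypergraph H(n,r,q | Σ): vertices are pairs (i , j) with
-- i : Fin n (class V_i) and j : Fin q.  An r-subset K of vertices is
-- given by its characteristic function.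

VSubset : ℕ → ℕ → Set
VSubset n q = Fin n → Fin q → Bool

card : ∀ {n q} → VSubset n q → ℕ
card {n} {q} K = ΣFin n (λ i → ΣFin q (λ j → b2n (K i j)))

classPartition : ∀ {n q} → VSubset n q → List ℕ
classPartition {n} {q} K = nonzeros (tab n (λ i → ΣFin q (λ j → b2n (K i j))))

IsEdge : (n r q : ℕ) → (Σ' : List ℕ → Bool) → VSubset n q → Set
IsEdge n r q Σ' K = card K ≡ r × Σ' (classPartition K) ≡ true

Colouring : ℕ → ℕ → ℕ → Set
Colouring n q k = Fin n → Fin q → Fin k

pat : ∀ {n q k} → Colouring n q k → VSubset n q → List ℕ
pat {n} {q} {k} c K =
  nonzeros (tab k (λ l → ΣFin n (λ i → ΣFin q (λ j →
    b2n (K i j ∧ does (c i j ≟ l))))))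

Surjective : ∀ {n q k} → Colouring n q k → Set
Surjective {n} {q} {k} c = ∀ (l : Fin k) → ∃[ i ] ∃[ j ] c i j ≡ l

IsQColouring : (n r q : ℕ) (Σ' Q : List ℕ → Bool) → ∀ {k} → Colouring n q k → Set
IsQColouring n r q Σ' Q c = ∀ K → IsEdge n r q Σ' K → Q (pat c K) ≡ true

InSpectrum : (n r q : ℕ) (Σ' Q : List ℕ → Bool) → ℕ → Set
InSpectrum n r q Σ' Q k =
  Σ (Colouring n q k) (λ c → Surjective c × IsQColouring n r q Σ' Q c)

HasGap : (n r q : ℕ) (Σ' Q : List ℕ → Bool) → Set
HasGap n r q Σ' Q =
  ∃[ k₁ ] ∃[ k₂ ] ∃[ k₃ ] (k₁ < k₂ × k₂ < k₃ ×
    InSpectrum n r q Σ' Q k₁ × ¬ InSpectrum n r q Σ' Q k₂ × InSpectrum n r q Σ' Q k₃)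

-- The constant colouring (every edge has pattern (r)) and the colouring by classes (the pattern
-- of an edge is its class partition) are Q-colourings with 1 and r² colours.  There is none
-- with k = r² − 1 colours: such a colouring is onto, and r − 1 classes show at most
-- r² − r < k colours, so a vertex of an unseen colour can always be found outside any r − 1
-- classes.  If every class is monochromatic, two classes A, B share a colour; realise σ ∈ Q,
-- whose reduction π = (a + b, …) lies outside Q, as an edge with a vertices in A, b in B and
-- each remaining part in a class of a fresh colour: its pattern is π.  Otherwise a class A has
-- two colours; for ρ ∈ Q with fewer than r parts put a part a ≥ 2 into A, covering both colours,
-- and every other part into a class of a fresh colour: this edge has class partition ρ, so its
-- pattern lies in Q and has more parts than ρ.  Starting from (r) this forces (1, …, 1) ∈ Q.
module Submission where

open import Defs
open import Data.Bool using (Bool; true; false; _∧_; if_then_else_)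
open import Data.Bool.Properties using (T-≡; ∧-identityʳ)
open import Data.Empty using (⊥-elim)
open import Data.Fin using (Fin; zero; suc; toℕ)
open import Data.Fin.Permutation using (Permutation′; _⟨$⟩ʳ_; transpose) renaming (id to idₚ)
open import Data.Fin.Properties using (_≟_; ¬∀⟶∃¬; all?; pigeonhole) renaming (<⇒≢ to <⇒≢ᶠ)
open import Data.List using (List; []; _∷_; [_]; _++_; map; filter; length; replicate; tabulate)
open import Data.List.Membership.Propositional using (_∈_; _∉_)
open import Data.List.Membership.Propositional.Properties
  using (∈-map⁺; ∈-∃++; ∈-++⁺ˡ; ∈-++⁺ʳ; ∈-tabulate⁺)
import Data.List.Membership.DecPropositional as DecMembership
open import Data.List.Properties using (filter-all; length-map; length-tabulate; length-++; map-∘; map-cong)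
open import Data.List.Relation.Binary.Permutation.Propositional
  using (_↭_; ↭-refl; ↭-reflexive; ↭-sym; ↭-trans; prep; swap; module PermutationReasoning)
open import Data.List.Relation.Binary.Permutation.Propositional.Properties
  using (filter-↭; shift; ∈-resp-↭; ↭-length; All-resp-↭)
open import Data.List.Relation.Binary.Subset.Propositional using (_⊆_)
open import Data.List.Relation.Unary.All using (All; []; _∷_)
import Data.List.Relation.Unary.All as All
import Data.List.Relation.Unary.All.Properties as All
open import Data.List.Relation.Unary.Any using (here; there)
open import Data.List.Relation.Unary.Unique.Propositional using (Unique; []; _∷_)
import Data.List.Relation.Unary.Unique.Propositional.Properties as Unique
open import Data.Nat using (ℕ; zero; suc; _+_; _*_; _∸_; _≤_; _<_; _<ᵇ_; z≤n; s≤s)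
open import Data.Nat.ListAction using (sum)
open import Data.Nat.ListAction.Properties using (sum-↭)
open import Data.Nat.Properties hiding (_≟_)
open import Algebra.Properties.CommutativeSemigroup *-commutativeSemigroup using (x∙yz≈y∙xz)
import Algebra.Properties.CommutativeMonoid.Sum +-0-commutativeMonoid as ℕSum
open import Data.Product using (_×_; _,_; proj₁; proj₂; map₁; map₂; ∃; ∃₂)
open import Function using (_∘_; id)
open import Function.Bundles using (Equivalence)
open import Relation.Binary.PropositionalEquality hiding ([_])
open import Relation.Nullary using (¬_; does; yes; no; contradiction)
open import Relation.Nullary.Decidable using (dec-true; dec-false)

ΣFin≡sum : ∀ n (f : Fin n → ℕ) → ΣFin n f ≡ ℕSum.sum f
ΣFin≡sum zero    f = refl
ΣFin≡sum (suc n) f = cong (f zero +_) (ΣFin≡sum n (f ∘ suc))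

ΣFin-cong : ∀ n {f g : Fin n → ℕ} → f ≗ g → ΣFin n f ≡ ΣFin n g
ΣFin-cong zero    f≗g = refl
ΣFin-cong (suc n) f≗g = cong₂ _+_ (f≗g zero) (ΣFin-cong n (f≗g ∘ suc))

ΣFin-zero : ∀ n → ΣFin n (λ _ → 0) ≡ 0
ΣFin-zero zero    = refl
ΣFin-zero (suc n) = ΣFin-zero n

ΣFin-distrib-+ : ∀ n (f g : Fin n → ℕ) → ΣFin n (λ i → f i + g i) ≡ ΣFin n f + ΣFin n g
ΣFin-distrib-+ n f g = begin
  ΣFin n (λ i → f i + g i)     ≡⟨ ΣFin≡sum n _ ⟩
  ℕSum.sum (λ i → f i + g i)   ≡⟨ ℕSum.∑-distrib-+ f g ⟩
  ℕSum.sum f + ℕSum.sum g      ≡⟨ cong₂ _+_ (ΣFin≡sum n f) (ΣFin≡sum n g) ⟨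
  ΣFin n f + ΣFin n g          ∎
  where open ≡-Reasoning

ΣFin-*ʳ : ∀ n (f : Fin n → ℕ) x → ΣFin n (λ i → f i * x) ≡ ΣFin n f * x
ΣFin-*ʳ zero    f x = refl
ΣFin-*ʳ (suc n) f x =
  trans (cong (f zero * x +_) (ΣFin-*ʳ n (f ∘ suc) x)) (sym (*-distribʳ-+ x (f zero) _))

ΣFin-permute : ∀ n (f : Fin n → ℕ) (π : Permutation′ n) → ΣFin n (f ∘ (π ⟨$⟩ʳ_)) ≡ ΣFin n f
ΣFin-permute n f π = begin
  ΣFin n (f ∘ (π ⟨$⟩ʳ_))       ≡⟨ ΣFin≡sum n _ ⟩
  ℕSum.sum (f ∘ (π ⟨$⟩ʳ_))     ≡⟨ ℕSum.sum-permute f π ⟨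
  ℕSum.sum f                   ≡⟨ ΣFin≡sum n f ⟨
  ΣFin n f                     ∎
  where open ≡-Reasoning

ΣFin-δˡ : ∀ n (h : Fin n → ℕ) p → ΣFin n (λ i → b2n (does (p ≟ i)) * h i) ≡ h p
ΣFin-δˡ (suc n) h zero    = trans (cong₂ _+_ (*-identityˡ (h zero)) (ΣFin-zero n)) (+-identityʳ (h zero))
ΣFin-δˡ (suc n) h (suc p) = ΣFin-δˡ n (h ∘ suc) p

ΣFin-δʳ : ∀ n (h : Fin n → ℕ) p → ΣFin n (λ i → b2n (does (i ≟ p)) * h i) ≡ h p
ΣFin-δʳ (suc n) h zero    = trans (cong₂ _+_ (*-identityˡ (h zero)) (ΣFin-zero n)) (+-identityʳ (h zero))
ΣFin-δʳ (suc n) h (suc p) = ΣFin-δʳ n (h ∘ suc) p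

term≤ΣFin : ∀ n (f : Fin n → ℕ) i → f i ≤ ΣFin n f
term≤ΣFin (suc n) f zero    = m≤m+n (f zero) _
term≤ΣFin (suc n) f (suc i) = ≤-trans (term≤ΣFin n (f ∘ suc) i) (m≤n+m _ (f zero))

ΣFin-initial : ∀ n z → z ≤ n → ΣFin n (λ j → b2n (toℕ j <ᵇ z)) ≡ z
ΣFin-initial n       zero    _         = ΣFin-zero n
ΣFin-initial (suc n) (suc z) (s≤s z≤n′) = cong suc (ΣFin-initial n z z≤n′)

tab-cong : ∀ m {f g : Fin m → ℕ} → f ≗ g → tab m f ≡ tab m g
tab-cong zero    f≗g = refl
tab-cong (suc m) f≗g = cong₂ _∷_ (f≗g zero) (tab-cong m (f≗g ∘ suc))

nonzeros≡filter : ∀ xs → nonzeros xs ≡ filter (1 ≤?_) xs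
nonzeros≡filter []           = refl
nonzeros≡filter (zero  ∷ xs) = nonzeros≡filter xs
nonzeros≡filter (suc x ∷ xs) = cong (suc x ∷_) (nonzeros≡filter xs)

nonzeros-↭ : ∀ {xs ys} → xs ↭ ys → nonzeros xs ↭ nonzeros ys
nonzeros-↭ {xs} {ys} xs↭ys rewrite nonzeros≡filter xs | nonzeros≡filter ys = filter-↭ (1 ≤?_) xs↭ys

nonzeros-positive : ∀ {xs} → All (1 ≤_) xs → nonzeros xs ≡ xs
nonzeros-positive {xs} pos = trans (nonzeros≡filter xs) (filter-all (1 ≤?_) pos)

nonzeros-prep : ∀ x xs ys → nonzeros xs ↭ nonzeros ys → nonzeros (x ∷ xs) ↭ nonzeros (x ∷ ys)
nonzeros-prep zero    _ _ p = p
nonzeros-prep (suc x) _ _ p = prep (suc x) p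

nonzeros-tab-zero : ∀ m → nonzeros (tab m (λ _ → 0)) ≡ []
nonzeros-tab-zero zero    = refl
nonzeros-tab-zero (suc m) = nonzeros-tab-zero m

nonzeros-tab-insert : ∀ m (h : Fin m → ℕ) p v → h p ≡ 0 →
  nonzeros (tab m (λ l → b2n (does (p ≟ l)) * v + h l)) ↭ nonzeros (v ∷ tab m h)
nonzeros-tab-insert (suc m) h zero    v hp rewrite hp | +-identityʳ (v + 0) | +-identityʳ v = ↭-refl
nonzeros-tab-insert (suc m) h (suc p) v hp = begin
  nonzeros (h zero ∷ t′)     ↭⟨ nonzeros-prep (h zero) t′ (v ∷ t) (nonzeros-tab-insert m (h ∘ suc) p v hp) ⟩
  nonzeros (h zero ∷ v ∷ t)  ↭⟨ nonzeros-↭ (swap (h zero) v (↭-refl {x = t})) ⟩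
  nonzeros (v ∷ h zero ∷ t)  ∎
  where
  open PermutationReasoning
  t t′ : List ℕ
  t  = tab m (h ∘ suc)
  t′ = tab m (λ l → b2n (does (p ≟ l)) * v + h (suc l))

tally : ∀ {m} → List (Fin m × ℕ) → Fin m → ℕ
tally []             l = 0
tally ((p , v) ∷ ps) l = b2n (does (p ≟ l)) * v + tally ps l

tally-merge : ∀ {m} (p : Fin m) a b ps l → tally ((p , a) ∷ (p , b) ∷ ps) l ≡ tally ((p , a + b) ∷ ps) l
tally-merge p a b ps l =
  trans (sym (+-assoc (δ * a) (δ * b) (tally ps l))) (cong (_+ tally ps l) (sym (*-distribˡ-+ δ a b)))
  where
  δ : ℕ
  δ = b2n (does (p ≟ l))

tally-∉ : ∀ {m} (ps : List (Fin m × ℕ)) {p} → p ∉ map proj₁ ps → tally ps p ≡ 0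
tally-∉ []             p∉ = refl
tally-∉ ((q , v) ∷ ps) {p} p∉ rewrite dec-false (q ≟ p) (p∉ ∘ here ∘ sym) = tally-∉ ps (p∉ ∘ there)

ΣFin-tally : ∀ m (ps : List (Fin m × ℕ)) → ΣFin m (tally ps) ≡ sum (map proj₂ ps)
ΣFin-tally m []             = ΣFin-zero m
ΣFin-tally m ((p , v) ∷ ps) =
  trans (ΣFin-distrib-+ m _ (tally ps)) (cong₂ _+_ (ΣFin-δˡ m (λ _ → v) p) (ΣFin-tally m ps))

nonzeros-tally : ∀ m (ps : List (Fin m × ℕ)) → Unique (map proj₁ ps) →
  nonzeros (tab m (tally ps)) ↭ nonzeros (map proj₂ ps)
nonzeros-tally m []             _           = ↭-reflexive (nonzeros-tab-zero m)
nonzeros-tally m ((p , v) ∷ ps) (p∉ ∷ uniq) = begin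
  nonzeros (tab m (tally ((p , v) ∷ ps)))
    ↭⟨ nonzeros-tab-insert m (tally ps) p v (tally-∉ ps (All.All¬⇒¬Any p∉)) ⟩
  nonzeros (v ∷ tab m (tally ps))
    ↭⟨ nonzeros-prep v (tab m (tally ps)) (map proj₂ ps) (nonzeros-tally m ps uniq) ⟩
  nonzeros (v ∷ map proj₂ ps) ∎
  where open PermutationReasoning

ΣFin-tally-fibres : ∀ m {k} (f : Fin m → Fin k) (ps : List (Fin m × ℕ)) l →
  ΣFin m (λ i → b2n (does (f i ≟ l)) * tally ps i) ≡ tally (map (map₁ f) ps) l
ΣFin-tally-fibres m f []             l =
  trans (ΣFin-cong m (λ i → *-zeroʳ (b2n (does (f i ≟ l))))) (ΣFin-zero m)
ΣFin-tally-fibres m f ((p , v) ∷ ps) l = begin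
  ΣFin m (λ i → δ i * (b2n (does (p ≟ i)) * v + tally ps i))
    ≡⟨ ΣFin-cong m (λ i → *-distribˡ-+ (δ i) _ (tally ps i)) ⟩
  ΣFin m (λ i → δ i * (b2n (does (p ≟ i)) * v) + δ i * tally ps i)
    ≡⟨ ΣFin-distrib-+ m _ _ ⟩
  ΣFin m (λ i → δ i * (b2n (does (p ≟ i)) * v)) + ΣFin m (λ i → δ i * tally ps i)
    ≡⟨ cong₂ _+_ (trans (ΣFin-cong m λ i → x∙yz≈y∙xz (δ i) (b2n (does (p ≟ i))) v)
                        (ΣFin-δˡ m (λ i → δ i * v) p))
                 (ΣFin-tally-fibres m f ps l) ⟩
  δ p * v + tally (map (map₁ f) ps) l ∎
  where
  open ≡-Reasoning
  δ : Fin m → ℕ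
  δ i = b2n (does (f i ≟ l))

Unique-++ : ∀ {A : Set} {xs ys : List A} → Unique xs → Unique ys → All (_∉ xs) ys → Unique (xs ++ ys)
Unique-++ uxs uys ys∉xs = Unique.++⁺ uxs uys λ (v∈xs , v∈ys) → All.lookup ys∉xs v∈ys v∈xs

Unique-⊆⇒length≤ : ∀ {A : Set} {xs ys : List A} → Unique xs → xs ⊆ ys → length xs ≤ length ys
Unique-⊆⇒length≤ []                     _     = z≤n
Unique-⊆⇒length≤ {xs = x ∷ xs} (x∉ ∷ u) xs⊆ys with ∈-∃++ (xs⊆ys (here refl))
... | as , bs , refl = begin
  suc (length xs)             ≤⟨ s≤s (Unique-⊆⇒length≤ u xs⊆as++bs) ⟩
  suc (length (as ++ bs))     ≡⟨ ↭-length (shift x as bs) ⟨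
  length (as ++ [ x ] ++ bs)  ∎
  where
  open ≤-Reasoning
  xs⊆as++bs : xs ⊆ as ++ bs
  xs⊆as++bs y∈xs with ∈-resp-↭ (shift x as bs) (xs⊆ys (there y∈xs))
  ... | here y≡x = ⊥-elim (All.lookup x∉ y∈xs (sym y≡x))
  ... | there y∈ = y∈

∃∉ : ∀ {k} (L : List (Fin k)) → length L < k → ∃ (_∉ L)
∃∉ {k} L short = ¬∀⟶∃¬ k (_∈ L) (_∈? L) λ all∈L →
  <⇒≱ short (subst (_≤ length L) (length-tabulate id)
                   (Unique-⊆⇒length≤ (Unique.allFin⁺ k) (λ {x} _ → all∈L x)))
  where open DecMembership (_≟_ {k}) using (_∈?_)

positives : ∀ k → (Fin k → ℕ) → List (Fin k)
positives zero    g = []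
positives (suc k) g with g zero
... | zero  = map suc (positives k (g ∘ suc))
... | suc _ = zero ∷ map suc (positives k (g ∘ suc))

length-positives : ∀ k (g : Fin k → ℕ) → length (positives k g) ≡ length (nonzeros (tab k g))
length-positives zero    g = refl
length-positives (suc k) g with g zero
... | zero  = trans (length-map suc (positives k (g ∘ suc))) (length-positives k (g ∘ suc))
... | suc _ = cong suc (trans (length-map suc (positives k (g ∘ suc))) (length-positives k (g ∘ suc)))

∈-positives : ∀ k (g : Fin k → ℕ) {l} → 1 ≤ g l → l ∈ positives k g
∈-positives (suc k) g {zero}  1≤gl with g zero
... | suc _ = here refl
∈-positives (suc k) g {suc l} 1≤gl with g zero
... | zero  = ∈-map⁺ suc (∈-positives k (g ∘ suc) 1≤gl)
... | suc _ = there (∈-map⁺ suc (∈-positives k (g ∘ suc) 1≤gl))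

length-nonzeros-tab≥ : ∀ k (g : Fin k → ℕ) {ds} → Unique ds → All (λ d → 1 ≤ g d) ds →
  length ds ≤ length (nonzeros (tab k g))
length-nonzeros-tab≥ k g uniq pos =
  subst (_ ≤_) (length-positives k g) (Unique-⊆⇒length≤ uniq (∈-positives k g ∘ All.lookup pos))

length≤sum : ∀ {xs} → All (1 ≤_) xs → length xs ≤ sum xs
length≤sum []          = z≤n
length≤sum (1≤x ∷ pos) = +-mono-≤ 1≤x (length≤sum pos)

∈⇒≤sum : ∀ {x xs} → x ∈ xs → x ≤ sum xs
∈⇒≤sum {xs = y ∷ xs} (here refl) = m≤m+n y (sum xs)
∈⇒≤sum {xs = y ∷ xs} (there x∈) = ≤-trans (∈⇒≤sum x∈) (m≤n+m (sum xs) y)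

split-large-part : ∀ {xs} → All (1 ≤_) xs → length xs < sum xs → ∃₂ λ a ys → 2 ≤ a × xs ↭ a ∷ ys
split-large-part {suc zero ∷ xs}    (_ ∷ pos) (s≤s len<) with split-large-part pos len<
... | a , ys , 2≤a , xs↭ = a , 1 ∷ ys , 2≤a , ↭-trans (prep 1 xs↭) (swap 1 a ↭-refl)
split-large-part {suc (suc x) ∷ xs} _         _          = suc (suc x) , xs , s≤s (s≤s z≤n) , ↭-refl

long-partition : ∀ xs → All (1 ≤_) xs → sum xs ≤ length xs → xs ≡ replicate (sum xs) 1
long-partition []                 _         _          = refl
long-partition (suc zero ∷ xs)    (_ ∷ pos) (s≤s sum≤) = cong (1 ∷_) (long-partition xs pos sum≤)
long-partition (suc (suc x) ∷ xs) (_ ∷ pos) (s≤s sum≤) =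
  contradiction (m≤n+m (sum xs) x) (<⇒≱ (≤-trans sum≤ (length≤sum pos)))

no-lengthening : ∀ {r Q} → IsPartitionFamily r Q → Q [ r ] ≡ true → Q (replicate r 1) ≡ false →
  ¬ (∀ ρ → Q ρ ≡ true → length ρ < r → ∃ λ ρ′ → Q ρ′ ≡ true × length ρ < length ρ′)
no-lengthening {r} {Q} (partition , _) Q[r] Q[1…1] lengthen with reach r ≤-refl
  where
  reach : ∀ m → m ≤ r → ∃ λ ρ → Q ρ ≡ true × m ≤ length ρ
  reach zero    _   = [ r ] , Q[r] , z≤n
  reach (suc m) m<r with reach m (<⇒≤ m<r)
  ... | ρ , Qρ , m≤ρ with r ≤? length ρ
  ...   | yes r≤ρ = ρ , Qρ , ≤-trans m<r r≤ρ
  ...   | no  r≰ρ with lengthen ρ Qρ (≰⇒> r≰ρ)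
  ...     | ρ′ , Qρ′ , ρ<ρ′ = ρ′ , Qρ′ , ≤-trans (s≤s m≤ρ) ρ<ρ′
... | ρ , Qρ , r≤ρ with partition ρ Qρ
...   | ρ-pos , refl =
  contradiction (trans (sym Qρ) (trans (cong Q (long-partition ρ ρ-pos r≤ρ)) Q[1…1])) λ ()

-- Vertex sets given class by class, and their colour counts

count : ∀ {q} → (Fin q → Bool) → ℕ
count {q} R = ΣFin q (λ j → b2n (R j))

Row : ℕ → ℕ → Set
Row n q = Fin n × (Fin q → Bool)

fromRows : ∀ {n q} → List (Row n q) → VSubset n q
fromRows []             i = λ _ → false
fromRows ((p , R) ∷ bs) i = if does (p ≟ i) then R else fromRows bs i

profile : ∀ {n q} → List (Row n q) → List (Fin n × ℕ)
profile = map (map₂ count)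

module _ {n q : ℕ} where

  keys-profile : (bs : List (Row n q)) → map proj₁ (profile bs) ≡ map proj₁ bs
  keys-profile bs = sym (map-∘ {g = proj₁} {f = map₂ count} bs)

  count-fromRows : (bs : List (Row n q)) → Unique (map proj₁ bs) →
    ∀ i → count (fromRows bs i) ≡ tally (profile bs) i
  count-fromRows []             _           i = ΣFin-zero q
  count-fromRows ((p , R) ∷ bs) (p∉ ∷ uniq) i with p ≟ i
  ... | yes refl = sym (trans (cong (1 * count R +_) (tally-∉ (profile bs) p∉bs))
                              (trans (+-identityʳ _) (*-identityˡ _)))
    where
    p∉bs : p ∉ map proj₁ (profile bs)
    p∉bs = subst (p ∉_) (sym (keys-profile bs)) (All.All¬⇒¬Any p∉)
  ... | no _     = count-fromRows bs uniq i

  fromRows-∈ : (bs : List (Row n q)) → Unique (map proj₁ bs) → ∀ {p R} → (p , R) ∈ bs → fromRows bs p ≡ R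
  fromRows-∈ ((p , R) ∷ bs) _           (here refl) rewrite dec-true (p ≟ p) refl = refl
  fromRows-∈ ((p , R) ∷ bs) (p∉ ∷ uniq) {p′} (there b∈) with p ≟ p′
  ... | yes refl = ⊥-elim (All.All¬⇒¬Any p∉ (∈-map⁺ proj₁ b∈))
  ... | no _     = fromRows-∈ bs uniq b∈

  card-fromRows : (bs : List (Row n q)) → Unique (map proj₁ bs) →
    card (fromRows bs) ≡ sum (map proj₂ (profile bs))
  card-fromRows bs uniq = trans (ΣFin-cong n (count-fromRows bs uniq)) (ΣFin-tally n (profile bs))

  classPartition-fromRows : (bs : List (Row n q)) → Unique (map proj₁ bs) →
    classPartition (fromRows bs) ↭ nonzeros (map proj₂ (profile bs))
  classPartition-fromRows bs uniq =
    ↭-trans (↭-reflexive (cong nonzeros (tab-cong n (count-fromRows bs uniq))))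
            (nonzeros-tally n (profile bs) (subst Unique (sym (keys-profile bs)) uniq))

fromRows-edge : ∀ {n r q Q} → IsPartitionFamily r Q → ∀ {σ} → Q σ ≡ true →
  (bs : List (Row n q)) → Unique (map proj₁ bs) → map proj₂ (profile bs) ↭ σ → IsEdge n r q Q (fromRows bs)
fromRows-edge (partition , Q-↭) {σ} Qσ bs uniq sizes↭σ =
  trans (card-fromRows bs uniq) (trans (sum-↭ sizes↭σ) (proj₂ (partition σ Qσ))) ,
  trans (Q-↭ _ σ classPartition↭σ) Qσ
  where
  sizes-positive : All (1 ≤_) (map proj₂ (profile bs))
  sizes-positive = All-resp-↭ (↭-sym sizes↭σ) (proj₁ (partition σ Qσ))
  classPartition↭σ : classPartition (fromRows bs) ↭ σ
  classPartition↭σ = ↭-trans (classPartition-fromRows bs uniq)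
                             (subst (_↭ σ) (sym (nonzeros-positive sizes-positive)) sizes↭σ)

colourCount : ∀ {n q k} → Colouring n q k → VSubset n q → Fin k → ℕ
colourCount {n} {q} c K l = ΣFin n (λ i → ΣFin q (λ j → b2n (K i j ∧ does (c i j ≟ l))))

b2n-∧ : ∀ x y → b2n (x ∧ y) ≡ b2n x * b2n y
b2n-∧ true  true  = refl
b2n-∧ true  false = refl
b2n-∧ false _     = refl

colourCount-present : ∀ {n q k} (c : Colouring n q k) K {i j} → K i j ≡ true → 1 ≤ colourCount c K (c i j)
colourCount-present {n} {q} c K {i} {j} Kij = begin
  1
    ≡⟨ cong₂ (λ x y → b2n (x ∧ y)) Kij (dec-true (c i j ≟ c i j) refl) ⟨
  b2n (K i j ∧ does (c i j ≟ c i j))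
    ≤⟨ term≤ΣFin q (λ j′ → b2n (K i j′ ∧ does (c i j′ ≟ c i j))) j ⟩
  ΣFin q (λ j′ → b2n (K i j′ ∧ does (c i j′ ≟ c i j)))
    ≤⟨ term≤ΣFin n _ i ⟩
  colourCount c K (c i j) ∎
  where open ≤-Reasoning

colourCount-classwise : ∀ {n q k} (c : Colouring n q k) (f : Fin n → Fin k) → (∀ i j → c i j ≡ f i) →
  ∀ K l → colourCount c K l ≡ ΣFin n (λ i → b2n (does (f i ≟ l)) * count (K i))
colourCount-classwise {n} {q} c f c≡f K l = ΣFin-cong n λ i → begin
  ΣFin q (λ j → b2n (K i j ∧ does (c i j ≟ l)))
    ≡⟨ ΣFin-cong q (λ j → trans (cong (λ x → b2n (K i j ∧ does (x ≟ l))) (c≡f i j)) (b2n-∧ (K i j) _)) ⟩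
  ΣFin q (λ j → b2n (K i j) * b2n (does (f i ≟ l)))
    ≡⟨ ΣFin-*ʳ q (λ j → b2n (K i j)) _ ⟩
  count (K i) * b2n (does (f i ≟ l))
    ≡⟨ *-comm (count (K i)) _ ⟩
  b2n (does (f i ≟ l)) * count (K i) ∎
  where open ≡-Reasoning

pat-constant : ∀ {n q} (K : VSubset n q) → pat {k = 1} (λ _ _ → zero) K ≡ nonzeros [ card K ]
pat-constant {n} {q} K =
  cong (λ x → nonzeros [ x ]) (ΣFin-cong n λ i → ΣFin-cong q λ j → cong b2n (∧-identityʳ (K i j)))

pat-classes : ∀ {n q} (K : VSubset n q) → pat (λ i _ → i) K ≡ classPartition K
pat-classes {n} K = cong nonzeros (tab-cong n λ l →
  trans (colourCount-classwise (λ i _ → i) id (λ _ _ → refl) K l) (ΣFin-δʳ n (count ∘ K) l))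

segment : ∀ {q} → Permutation′ q → ℕ → Fin q → Bool
segment π z j = toℕ (π ⟨$⟩ʳ j) <ᵇ z

count-segment : ∀ {q} (π : Permutation′ q) {z} → z ≤ q → count (segment π z) ≡ z
count-segment {q} π {z} z≤q = trans (ΣFin-permute q (λ j → b2n (toℕ j <ᵇ z)) π) (ΣFin-initial q z z≤q)

segment-∋ : ∀ {q} (π : Permutation′ q) {z j} → toℕ (π ⟨$⟩ʳ j) < z → segment π z j ≡ true
segment-∋ π lt = Equivalence.to T-≡ (<⇒<ᵇ lt)

transpose-to : ∀ {q} (i j : Fin q) → transpose i j ⟨$⟩ʳ j ≡ i
transpose-to i j with j ≟ i
... | yes j≡i = j≡i
... | no  _   rewrite dec-true (j ≟ j) refl = refl

transpose-fixes : ∀ {q} (i j : Fin q) {k} → k ≢ i → k ≢ j → transpose i j ⟨$⟩ʳ k ≡ k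
transpose-fixes i j {k} k≢i k≢j rewrite dec-false (k ≟ i) k≢i | dec-false (k ≟ j) k≢j = refl

record Pick (n q : ℕ) : Set where
  constructor pick
  field
    size   : ℕ
    class  : Fin n
    vertex : Fin q
open Pick

-- `size` vertices of `class`, among them `vertex` (moved to rank 0).
pickRow : ∀ {n q} → Pick n (suc q) → Row n (suc q)
pickRow w = class w , segment (transpose zero (vertex w)) (size w)

module _ {n q : ℕ} where

  profile-pickRows : (ws : List (Pick n (suc q))) → All (λ w → size w ≤ suc q) ws →
    profile (map pickRow ws) ≡ map (λ w → class w , size w) ws
  profile-pickRows []       []           = refl
  profile-pickRows (w ∷ ws) (w≤q ∷ ws≤q) =
    cong₂ _∷_ (cong (class w ,_) (count-segment (transpose zero (vertex w)) w≤q)) (profile-pickRows ws ws≤q)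

  sizes-pickRows : ∀ {ws : List (Pick n (suc q))} {xs} → map size ws ≡ xs → All (_≤ suc q) xs →
    map proj₂ (profile (map pickRow ws)) ≡ xs
  sizes-pickRows {ws} refl xs≤q = begin
    map proj₂ (profile (map pickRow ws))         ≡⟨ cong (map proj₂) (profile-pickRows ws (All.map⁻ xs≤q)) ⟩
    map proj₂ (map (λ w → class w , size w) ws)  ≡⟨ map-∘ ws ⟨
    map size ws                                  ∎
    where open ≡-Reasoning

  pickRow-∋ : ∀ bs (ws : List (Pick n (suc q))) → Unique (map proj₁ (bs ++ map pickRow ws)) →
    ∀ {w} → w ∈ ws → 1 ≤ size w → fromRows (bs ++ map pickRow ws) (class w) (vertex w) ≡ true
  pickRow-∋ bs ws uniq {w} w∈ 1≤w =
    trans (cong (λ R → R (vertex w))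
                (fromRows-∈ (bs ++ map pickRow ws) uniq (∈-++⁺ʳ bs (∈-map⁺ pickRow w∈))))
          (segment-∋ (transpose zero (vertex w)) {j = vertex w}
                     (subst (λ j → toℕ j < size w) (sym (transpose-to zero (vertex w))) 1≤w))

-- Picking vertices of fresh colours in fresh classes

module _ {n q k} (c : Colouring n q k) where

  palette : List (Fin n) → List (Fin k)
  palette []      = []
  palette (i ∷ U) = tabulate (c i) ++ palette U

  length-palette : ∀ U → length (palette U) ≡ length U * q
  length-palette []      = refl
  length-palette (i ∷ U) =
    trans (length-++ (tabulate (c i))) (cong₂ _+_ (length-tabulate (c i)) (length-palette U))

  ∈-palette : ∀ {i U} j → i ∈ U → c i j ∈ palette U
  ∈-palette {U = i ∷ U}  j (here refl) = ∈-++⁺ˡ (∈-tabulate⁺ j)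
  ∈-palette {U = i′ ∷ U} j (there i∈) = ∈-++⁺ʳ (tabulate (c i′)) (∈-palette j i∈)

  colour : Pick n q → Fin k
  colour w = c (class w) (vertex w)

  data Rainbow (U : List (Fin n)) : List (Pick n q) → Set where
    []  : Rainbow U []
    _∷_ : ∀ {w ws} → colour w ∉ palette U → Rainbow (class w ∷ U) ws → Rainbow U (w ∷ ws)

  Rainbow-classes : ∀ {U ws} → Rainbow U ws → All (_∉ U) (map class ws) × Unique (map class ws)
  Rainbow-classes []                    = [] , []
  Rainbow-classes {U} (fresh ∷ rest) with Rainbow-classes rest
  ... | ∉U′ , uniq =
    (fresh ∘ ∈-palette {U = U} _) ∷ All.map (_∘ there) ∉U′ ,
    All.map (λ i′∉ i≡i′ → i′∉ (here (sym i≡i′))) ∉U′ ∷ uniq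

  Rainbow-colours : ∀ {U ws} → Rainbow U ws → All (_∉ palette U) (map colour ws) × Unique (map colour ws)
  Rainbow-colours []                         = [] , []
  Rainbow-colours {U} {w ∷ _} (fresh ∷ rest) with Rainbow-colours rest
  ... | ∉U′ , uniq =
    fresh ∷ All.map (_∘ ∈-++⁺ʳ (tabulate (c (class w)))) ∉U′ ,
    All.map (λ d∉ w≡d → d∉ (subst (_∈ palette (class w ∷ U)) w≡d w∈)) ∉U′ ∷ uniq
    where
    w∈ : colour w ∈ palette (class w ∷ U)
    w∈ = ∈-palette {U = class w ∷ U} (vertex w) (here refl)

  Rainbow-keys : ∀ {U ws} → Unique U → Rainbow U ws → Unique (U ++ map class ws)
  Rainbow-keys uniqU rb = Unique-++ uniqU (proj₂ (Rainbow-classes rb)) (proj₁ (Rainbow-classes rb))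

  Rainbow-distinct-colours : ∀ {U ws ds} → Unique ds → ds ⊆ palette U → Rainbow U ws →
    Unique (ds ++ map colour ws)
  Rainbow-distinct-colours uniq ds⊆ rb =
    Unique-++ uniq (proj₂ (Rainbow-colours rb)) (All.map (_∘ ds⊆) (proj₁ (Rainbow-colours rb)))

  fresh-vertex : Surjective c → ∀ U → length U * q < k → ∃₂ λ i j → c i j ∉ palette U
  fresh-vertex surj U short with ∃∉ (palette U) (subst (_< k) (sym (length-palette U)) short)
  ... | γ , γ∉ with surj γ
  ...   | i , j , refl = i , j , γ∉

  rainbow : ∀ {m} → (∀ U → length U < m → ∃₂ λ i j → c i j ∉ palette U) →
    ∀ U xs → length U + length xs ≤ m → ∃ λ ws → map size ws ≡ xs × Rainbow U ws
  rainbow fresh U []       _    = [] , refl , []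
  rainbow {m} fresh U (x ∷ xs) room =
    let i , j , cij∉    = fresh U (≤-trans (s≤s (m≤m+n _ (length xs))) room′)
        ws , sizes , rb = rainbow fresh (i ∷ U) xs room′
    in  pick x i j ∷ ws , cong (x ∷_) sizes , cij∉ ∷ rb
    where
    room′ : suc (length U + length xs) ≤ m
    room′ = subst (_≤ m) (+-suc (length U) (length xs)) room

-- No Q-colouring of H(r², r, r | Q) with r² − 1 colours

module _ (t : ℕ) where

  private
    r : ℕ
    r = suc (suc t)

  1<r*r∸1 : 1 < r * r ∸ 1
  1<r*r∸1 = s≤s (≤-trans (s≤s z≤n) (m≤n+m (suc t * r) t))

  r*r∸1<r*r : r * r ∸ 1 < r * r
  r*r∸1<r*r = ≤-refl

  fewer-than-r-classes : ∀ u → u < r → u * r < r * r ∸ 1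
  fewer-than-r-classes u u<r = ∸-monoˡ-≤ 1 (≤-trans (s≤s (s≤s (m≤n+m (u * r) t))) (*-monoˡ-≤ r u<r))

module _ (t : ℕ) {Q : List ℕ → Bool} (fam : IsPartitionFamily (suc (suc t)) Q) where

  private
    r n k : ℕ
    r = suc (suc t)
    n = r * r
    k = r * r ∸ 1

  module _ {ρ ps} (Qρ : Q ρ ≡ true) (ρ↭ : ρ ↭ ps) where

    parts-pos : All (1 ≤_) ps
    parts-pos = All-resp-↭ ρ↭ (proj₁ (proj₁ fam ρ Qρ))

    parts-sum : sum ps ≡ r
    parts-sum = trans (sym (sum-↭ ρ↭)) (proj₂ (proj₁ fam ρ Qρ))

    parts≤r : All (_≤ r) ps
    parts≤r = All.tabulate λ {x} x∈ → subst (x ≤_) parts-sum (∈⇒≤sum x∈)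

    few-parts : length ps ≤ r
    few-parts = subst (length ps ≤_) parts-sum (length≤sum parts-pos)

  module _ (c : Colouring n r k) (surj : Surjective c) (Q-col : IsQColouring n r r Q Q c) where

    fresh : ∀ U → length U < r → ∃₂ λ i j → c i j ∉ palette c U
    fresh U U<r = fresh-vertex c surj U (fewer-than-r-classes t _ U<r)

    module Lengthening {A : Fin n} {j₀ : Fin r} (j₀-new : c A j₀ ≢ c A zero)
                       {ρ a xs} (Qρ : Q ρ ≡ true) (ρ↭ : ρ ↭ a ∷ xs) (2≤a : 2 ≤ a)
                       {ws} (ws-sizes : map size ws ≡ xs) (rb : Rainbow c [ A ] ws) where

      -- Vertex j₀ goes to rank 1, so the part a ≥ 2 in A meets both colours c A 0 and c A j₀.
      rows : List (Row n r)
      rows = (A , segment (transpose (suc zero) j₀) a) ∷ map pickRow ws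

      K : VSubset n r
      K = fromRows rows

      keys-unique : Unique (map proj₁ rows)
      keys-unique = subst (Unique ∘ (A ∷_)) (map-∘ ws) (Rainbow-keys c ([] ∷ []) rb)

      K-edge : IsEdge n r r Q K
      K-edge = fromRows-edge fam Qρ rows keys-unique (subst (_↭ ρ) (sym sizes) (↭-sym ρ↭))
        where
        sizes : map proj₂ (profile rows) ≡ a ∷ xs
        sizes = cong₂ _∷_ (count-segment (transpose (suc zero) j₀) (All.head (parts≤r Qρ ρ↭)))
                          (sizes-pickRows ws-sizes (All.tail (parts≤r Qρ ρ↭)))

      A-∋ : ∀ {j} → toℕ (transpose (suc zero) j₀ ⟨$⟩ʳ j) < a → K A j ≡ true
      A-∋ {j} lt = trans (cong (λ R → R j) (fromRows-∈ rows keys-unique (here refl)))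
                         (segment-∋ (transpose (suc zero) j₀) {j = j} lt)

      present : All (λ d → 1 ≤ colourCount c K d) (c A zero ∷ c A j₀ ∷ map (colour c) ws)
      present =
        colourCount-present c K (A-∋ (subst (λ j → toℕ j < a) (sym zero-fixed) (All.head (parts-pos Qρ ρ↭)))) ∷
        colourCount-present c K (A-∋ (subst (λ j → toℕ j < a) (sym (transpose-to (suc zero) j₀)) 2≤a)) ∷
        All.map⁺ (All.tabulate λ w∈ → colourCount-present c K
          (pickRow-∋ [ A , _ ] ws keys-unique w∈ (All.lookup (All-sizes (All.tail (parts-pos Qρ ρ↭))) w∈)))
        where
        zero-fixed : transpose (suc zero) j₀ ⟨$⟩ʳ zero ≡ zero
        zero-fixed = transpose-fixes (suc zero) j₀ (λ ()) λ 0≡j₀ → j₀-new (cong (c A) (sym 0≡j₀))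
        All-sizes : ∀ {P : ℕ → Set} → All P xs → All (P ∘ size) ws
        All-sizes = All.map⁻ ∘ subst (All _) (sym ws-sizes)

      present-unique : Unique (c A zero ∷ c A j₀ ∷ map (colour c) ws)
      present-unique = Rainbow-distinct-colours c (((j₀-new ∘ sym) ∷ []) ∷ [] ∷ []) ⊆palette rb
        where
        ⊆palette : c A zero ∷ c A j₀ ∷ [] ⊆ palette c [ A ]
        ⊆palette (here refl)         = ∈-palette c {U = [ A ]} zero (here refl)
        ⊆palette (there (here refl)) = ∈-palette c {U = [ A ]} j₀ (here refl)

      longer : length ρ < length (pat c K)
      longer = begin-strict
        length ρ                          ≡⟨ ↭-length ρ↭ ⟩
        suc (length xs)                   ≡⟨ cong (suc ∘ length) ws-sizes ⟨
        suc (length (map size ws))        ≡⟨ cong suc (trans (length-map size ws) (sym (length-map (colour c) ws))) ⟩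
        suc (length (map (colour c) ws))  <⟨ ≤-refl ⟩
        length (c A zero ∷ c A j₀ ∷ map (colour c) ws)
                                          ≤⟨ length-nonzeros-tab≥ k (colourCount c K) present-unique present ⟩
        length (pat c K)                  ∎
        where open ≤-Reasoning

    module Merging (mono : ∀ i j → c i j ≡ c i zero) {A B : Fin n} (A≢B : A ≢ B) (fA≡fB : c A zero ≡ c B zero)
                   {σ π a b xs} (Qσ : Q σ ≡ true) (σ↭ : σ ↭ a ∷ b ∷ xs) (π↭ : π ↭ a + b ∷ xs)
                   {ws} (ws-sizes : map size ws ≡ xs) (rb : Rainbow c (A ∷ B ∷ []) ws) where

      f : Fin n → Fin k
      f i = c i zero

      rows : List (Row n r)
      rows = (A , segment idₚ a) ∷ (B , segment idₚ b) ∷ map pickRow ws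

      K : VSubset n r
      K = fromRows rows

      keys-unique : Unique (map proj₁ rows)
      keys-unique =
        subst (Unique ∘ λ is → A ∷ B ∷ is) (map-∘ ws) (Rainbow-keys c ((A≢B ∷ []) ∷ [] ∷ []) rb)

      class-sizes : List (Fin n × ℕ)
      class-sizes = map (λ w → class w , size w) ws

      colour-sizes : List (Fin k × ℕ)
      colour-sizes = map (λ w → colour c w , size w) ws

      profile-rows : profile rows ≡ (A , a) ∷ (B , b) ∷ class-sizes
      profile-rows =
        cong₂ _∷_ (cong (A ,_) (count-segment idₚ (All.head parts≤r′)))
          (cong₂ _∷_ (cong (B ,_) (count-segment idₚ (All.head (All.tail parts≤r′))))
            (profile-pickRows ws (All.map⁻ (subst (All _) (sym ws-sizes) (All.tail (All.tail parts≤r′))))))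
        where
        parts≤r′ = parts≤r Qσ σ↭

      K-edge : IsEdge n r r Q K
      K-edge = fromRows-edge fam Qσ rows keys-unique (subst (_↭ σ) (sym sizes) (↭-sym σ↭))
        where
        sizes : map proj₂ (profile rows) ≡ a ∷ b ∷ xs
        sizes = trans (cong (map proj₂) profile-rows) (cong (λ ys → a ∷ b ∷ ys) (trans (sym (map-∘ ws)) ws-sizes))

      recoloured-profile : map (map₁ f) (profile rows) ≡ (f A , a) ∷ (f A , b) ∷ colour-sizes
      recoloured-profile = begin
        map (map₁ f) (profile rows)
          ≡⟨ cong (map (map₁ f)) profile-rows ⟩
        (f A , a) ∷ (f B , b) ∷ map (map₁ f) class-sizes
          ≡⟨ cong₂ (λ p ys → (f A , a) ∷ (p , b) ∷ ys) fA≡fB recolour ⟨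
        (f A , a) ∷ (f A , b) ∷ colour-sizes ∎
        where
        open ≡-Reasoning
        recolour : colour-sizes ≡ map (map₁ f) class-sizes
        recolour = trans (map-cong (λ w → cong (_, size w) (mono (class w) (vertex w))) ws) (map-∘ ws)

      colourCount-K : ∀ l → colourCount c K l ≡ tally ((f A , a + b) ∷ colour-sizes) l
      colourCount-K l = begin
        colourCount c K l
          ≡⟨ colourCount-classwise c f mono K l ⟩
        ΣFin n (λ i → b2n (does (f i ≟ l)) * count (K i))
          ≡⟨ ΣFin-cong n (λ i → cong (b2n (does (f i ≟ l)) *_) (count-fromRows rows keys-unique i)) ⟩
        ΣFin n (λ i → b2n (does (f i ≟ l)) * tally (profile rows) i)
          ≡⟨ ΣFin-tally-fibres n f (profile rows) l ⟩
        tally (map (map₁ f) (profile rows)) l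
          ≡⟨ cong (λ ps → tally ps l) recoloured-profile ⟩
        tally ((f A , a) ∷ (f A , b) ∷ colour-sizes) l
          ≡⟨ tally-merge (f A) a b colour-sizes l ⟩
        tally ((f A , a + b) ∷ colour-sizes) l ∎
        where open ≡-Reasoning

      colour-keys-unique : Unique (map proj₁ ((f A , a + b) ∷ colour-sizes))
      colour-keys-unique = subst (Unique ∘ (f A ∷_)) (map-∘ ws) (Rainbow-distinct-colours c ([] ∷ []) fA∈ rb)
        where
        fA∈ : [ f A ] ⊆ palette c (A ∷ B ∷ [])
        fA∈ (here refl) = ∈-palette c {U = A ∷ B ∷ []} zero (here refl)

      pattern↭π : pat c K ↭ π
      pattern↭π = begin
        pat c K
          ≡⟨ cong nonzeros (tab-cong k colourCount-K) ⟩
        nonzeros (tab k (tally ((f A , a + b) ∷ colour-sizes)))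
          ↭⟨ nonzeros-tally k _ colour-keys-unique ⟩
        nonzeros (a + b ∷ map proj₂ colour-sizes)
          ≡⟨ cong (nonzeros ∘ (a + b ∷_)) (trans (sym (map-∘ ws)) ws-sizes) ⟩
        nonzeros (a + b ∷ xs)
          ≡⟨ nonzeros-positive (a+b-pos ∷ All.tail (All.tail parts-pos′)) ⟩
        a + b ∷ xs
          ↭⟨ ↭-sym π↭ ⟩
        π ∎
        where
        open PermutationReasoning
        parts-pos′ = parts-pos Qσ σ↭
        a+b-pos = ≤-trans (All.head parts-pos′) (m≤m+n a b)

    lengthen : ∀ {A j₀} → c A j₀ ≢ c A zero →
      ∀ ρ → Q ρ ≡ true → length ρ < r → ∃ λ ρ′ → Q ρ′ ≡ true × length ρ < length ρ′
    lengthen {A} j₀-new ρ Qρ ρ<r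
      with split-large-part (parts-pos Qρ ↭-refl) (subst (length ρ <_) (sym (parts-sum Qρ ↭-refl)) ρ<r)
    ... | a , xs , 2≤a , ρ↭ with rainbow c fresh [ A ] xs (few-parts Qρ ρ↭)
    ...   | ws , ws-sizes , rb = pat c K , Q-col K K-edge , longer
      where open Lengthening j₀-new Qρ ρ↭ 2≤a ws-sizes rb

    classes-not-monochromatic : NotReductionClosed Q → ¬ (∀ i j → c i j ≡ c i zero)
    classes-not-monochromatic (σ , π , Qσ , (a , b , xs , σ↭ , π↭) , Qπ) mono
      with pigeonhole (r*r∸1<r*r t) (λ i → c i zero)
    ... | A , B , A<B , fA≡fB with rainbow c fresh (A ∷ B ∷ []) xs (few-parts Qσ σ↭)
    ...   | ws , ws-sizes , rb =
      contradiction (trans (sym (Q-col K K-edge)) (trans (proj₂ fam _ _ pattern↭π) Qπ)) λ ()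
      where open Merging mono (<⇒≢ᶠ A<B) fA≡fB Qσ σ↭ π↭ ws-sizes rb

  no-colouring : Q [ r ] ≡ true → Q (replicate r 1) ≡ false → NotReductionClosed Q →
    ¬ InSpectrum n r r Q Q k
  no-colouring Q[r] Q[1…1] nrc (c , surj , Q-col) with all? (λ i → all? λ j → c i j ≟ c i zero)
  ... | yes mono  = classes-not-monochromatic c surj Q-col nrc mono
  ... | no  ¬mono =
    let A  , ¬monoA = ¬∀⟶∃¬ n _ (λ i → all? λ j → c i j ≟ c i zero) ¬mono
        j₀ , j₀-new = ¬∀⟶∃¬ r _ (λ j → c A j ≟ c A zero) ¬monoA
    in  no-lengthening fam Q[r] Q[1…1] (lengthen c surj Q-col j₀-new)

constant-colouring : ∀ {n r q Σ′ Q} → Q (nonzeros [ r ]) ≡ true → InSpectrum (suc n) r (suc q) Σ′ Q 1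
constant-colouring {Q = Q} Q[r] =
  (λ _ _ → zero) , (λ { zero → zero , zero , refl }) ,
  λ K (card≡r , _) → trans (cong Q (trans (pat-constant K) (cong (λ x → nonzeros [ x ]) card≡r))) Q[r]

class-colouring : ∀ {n r q Q} → InSpectrum n r (suc q) Q Q n
class-colouring {Q = Q} = (λ i _ → i) , (λ i → i , zero , refl) , λ K (_ , QK) → trans (cong Q (pat-classes K)) QK

lemma4p5 : (r : ℕ) → 2 ≤ r → (Q : List ℕ → Bool) → IsPartitionFamily r Q →
    Q [ r ] ≡ true → Q (replicate r 1) ≡ false → NotReductionClosed Q →
    HasGap (r * r) r r Q Q
lemma4p5 (suc zero)    (s≤s ())
lemma4p5 (suc (suc t)) _ Q fam Q[r] Q[1…1] nrc =
  1 , suc (suc t) * suc (suc t) ∸ 1 , suc (suc t) * suc (suc t) ,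
  1<r*r∸1 t , r*r∸1<r*r t ,
  constant-colouring {Σ′ = Q} {Q} Q[r] , no-colouring t fam Q[r] Q[1…1] nrc , class-colouring {Q = Q}
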